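{- Let $B(z)=\sum_n B_n z^n$, where $B_n$ is the number of closed linear $\lambda$-terms of size $n$ with no closed proper subterm. Then $$B(z)+2zB(z)^2 = z^2 + 2z\,B(z)\cdot z B'(z).$$
   Context: $\lambda$-terms are built from variables, applications $(t~u)$ and abstractions $\lambda x.t$, up to $\alpha$-equivalence. A term is linear if each variable is used exactly once, and closed if it has no free variables. Size is defined by $|x|=1$, $|(t~u)|=1+|t|+|u|$, $|\lambda x.t|=1+|t|$. A closed proper subterm is an occurrence of a closed subterm other than the term itself. The paper writes this as the class equation $\mathcal{B}_0+2\mathcal{Z}\mathcal{B}_0^2=\mathcal{Z}^2+2\mathcal{Z}\mathcal{B}_0\mathcal{B}_0^\bullet$, where ${}^\bullet$ denotes pointing, with generating function $zB'(z)$. -}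

module Defs where

open import Data.Nat using (ℕ; zero; suc; _+_; _*_; _∸_)
open import Data.Nat.Base using (_≡ᵇ_)
open import Data.Fin using (Fin)
open import Data.Bool using (Bool; true; false; _∧_; not; T)
open import Data.List using (List; map; upTo; allFin)
open import Data.Nat.ListAction using (sum)
open import Data.Bool.ListAction using (all)
open import Data.Product using (Σ; _×_)
open import Relation.Binary.PropositionalEquality using (_≡_)

-- λ-terms up to α-equivalence: well-scoped de Bruijn terms.
-- Term n = terms with at most n free variables (indices Fin n).

data Term : ℕ → Set where
  var : ∀ {n} → Fin n → Term n
  app : ∀ {n} → Term n → Term n → Term n
  lam : ∀ {n} → Term (suc n) → Term n

size : ∀ {n} → Term n → ℕ
size (var _)   = 1
size (app t u) = suc (size t + size u)
size (lam t)   = suc (size t)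

occ : ∀ {n} → Term n → Fin n → ℕ
occ (var j)   i = if-eq j i
  where
  if-eq : ∀ {n} → Fin n → Fin n → ℕ
  if-eq Fin.zero    Fin.zero    = 1
  if-eq Fin.zero    (Fin.suc _) = 0
  if-eq (Fin.suc _) Fin.zero    = 0
  if-eq (Fin.suc a) (Fin.suc b) = if-eq a b
occ (app t u) i = occ t i + occ u i
occ (lam t)   i = occ t (Fin.suc i)

-- a (subterm occurrence) is closed iff it uses none of the variables of its context
isClosed : ∀ {n} → Term n → Bool
isClosed {n} t = all (λ i → occ t i ≡ᵇ 0) (allFin n)

-- linear: every bound variable is used exactly once
-- (for closed terms every variable is bound, so this is linearity)
isLinear : ∀ {n} → Term n → Bool
isLinear (var _)   = true
isLinear (app t u) = isLinear t ∧ isLinear u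
isLinear (lam t)   = (occ t Fin.zero ≡ᵇ 1) ∧ isLinear t

noClosedProperSubterm : ∀ {n} → Term n → Bool
noClosedProperSubterm (var _)   = true
noClosedProperSubterm (app t u) =
  not (isClosed t) ∧ not (isClosed u) ∧
  noClosedProperSubterm t ∧ noClosedProperSubterm u
noClosedProperSubterm (lam t)   = not (isClosed t) ∧ noClosedProperSubterm t

BTerm : ℕ → Set
BTerm n = Σ (Term 0) (λ t → (size t ≡ n) × (T (isLinear t) × T (noClosedProperSubterm t)))

Series : Set
Series = ℕ → ℕ

infixl 6 _⊕_
infixl 7 _⊗_

_⊕_ : Series → Series → Series
(f ⊕ g) n = f n + g n

_⊗_ : Series → Series → Series
(f ⊗ g) n = sum (map (λ i → f i * g (n ∸ i)) (upTo (suc n)))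

_·_ : ℕ → Series → Series
(c · f) n = c * f n

Z : Series
Z 1 = 1
Z _ = 0

D : Series → Series
D f n = suc n * f (suc n)

{-# OPTIONS --safe #-}
-- A closed linear term without closed proper subterms is λx.x or λy.λx.r. In the second case
-- y occurs once in r; the maximal subterm u of r whose only variable is y is one side of an
-- application whose other side w does not mention y. Replacing that application by w leaves
-- a body x′ with a marked occurrence (that of w); λy.u and λx.x′ are again in the class, the
-- mark lies strictly below the root of λx.x′, and together with the side of u this data
-- determines the term. A term of size c has c positions, one of which is the root, so
-- B_{n+1} = [n = 1] + 2 Σ_{a+c=n} B_a (c B_c − B_c), that is B = z² + 2zB(zB′ − B).
module Submission where

open import Defs
open import Algebra.Bundles using (CommutativeMonoid)
import Algebra.Properties.CommutativeSemigroup as CommutativeSemigroupProperties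
open import Data.Bool using (Bool; true; false; _∧_; not; T)
open import Data.Bool.Properties using (T-∧; T-irrelevant; ∧-assoc; ∧-comm; ∧-commutativeMonoid)
open import Data.Empty using (⊥; ⊥-elim)
open import Data.Fin using (Fin; zero; suc; toℕ; fromℕ; fromℕ<; inject₁; lift; _≟_)
open import Data.Fin.Permutation using (↔⇒≡)
open import Data.Fin.Properties
  using (inject₁-injective; fromℕ≢inject₁; lift-injective; any?; all?; ¬∀⟶∃¬
        ; toℕ≤pred[n]; toℕ-fromℕ<; fromℕ<-toℕ; +↔⊎; *↔×; 0↔⊥; 1↔⊤; 2↔Bool)
  renaming (suc-injective to fsuc-injective)
open import Data.List using (map; applyUpTo; allFin)
open import Data.List.Membership.Propositional.Properties using (∈-allFin)
import Data.List.Relation.Unary.All as All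
open import Data.List.Relation.Unary.All.Properties using (all⁺; all⁻)
open import Data.Nat using (ℕ; zero; suc; _+_; _*_; _∸_; _≡ᵇ_; s≤s)
import Data.Nat as ℕ
open import Data.Nat.ListAction using (sum)
open import Data.Nat.Properties
  using (≡ᵇ⇒≡; ≡⇒≡ᵇ; ≡-irrelevant; suc-injective; 1+n≢0; m+n≡0⇒m≡0; m+n≡0⇒n≡0
        ; +-comm; +-assoc; +-suc; +-identityʳ; *-identityˡ; +-commutativeSemigroup
        ; m+[n∸m]≡n; m+n∸m≡n; m≤m+n)
open import Data.Product using (Σ; Σ-syntax; ∃-syntax; ∄-syntax; _×_; _,_; proj₁; proj₂)
open import Data.Product.Algebra using (×-cong; ×-comm)
open import Data.Product.Function.Dependent.Propositional using (congˡ; Σ-↔)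
open import Data.Sum using (_⊎_; inj₁; inj₂)
open import Data.Sum.Algebra using (⊎-cong; ⊎-comm; ⊎-assoc)
open import Data.Unit using (⊤; tt)
open import Function using (_∘_; id)
open import Function.Bundles using (_⇔_; mk⇔; Equivalence; _↔_; mk↔ₛ′)
open import Function.Definitions using (Injective)
import Function.Properties.Equivalence as ⇔
open import Function.Properties.Inverse using (↔-refl; ↔-sym; ↔-trans)
open import Function.Related.Propositional using (≡⇒)
open import Function.Related.TypeIsomorphisms using (Σ-distribˡ-⊎; ×-distribˡ-⊎)
open import Relation.Binary.PropositionalEquality
open import Relation.Nullary using (¬_; Dec; yes; no)

module +-Properties = CommutativeSemigroupProperties +-commutativeSemigroup
module ∧-Properties =
  CommutativeSemigroupProperties (CommutativeMonoid.commutativeSemigroup ∧-commutativeMonoid)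

private variable
  m n k : ℕ

infixr 5 _⟫_
_⟫_ : {A B C : Set} → A ↔ B → B ↔ C → A ↔ C
_⟫_ = ↔-trans

m+n≡1-cases : ∀ m n → m + n ≡ 1 → (m ≡ 0 × n ≡ 1) ⊎ (m ≡ 1 × n ≡ 0)
m+n≡1-cases zero       n    e = inj₁ (refl , e)
m+n≡1-cases (suc zero) zero _ = inj₂ (refl , refl)

Closed : Term n → Set
Closed t = ∀ i → occ t i ≡ 0

Open : Term n → Set
Open t = T (not (isClosed t))

Linear : Term n → Set
Linear t = T (isLinear t)

NoClosedProper : Term n → Set
NoClosedProper t = T (noClosedProperSubterm t)

NoClosedSubterm : Term n → Set
NoClosedSubterm t = Open t × NoClosedProper t

T-not⇔¬T : ∀ {b} → T (not b) ⇔ (¬ T b)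
T-not⇔¬T {false} = mk⇔ (λ _ ()) (λ _ → tt)
T-not⇔¬T {true}  = mk⇔ (λ ()) (λ ¬b → ¬b tt)

T-⇔⇒≡ : ∀ {b c} → T b ⇔ T c → b ≡ c
T-⇔⇒≡ {false} {false} _   = refl
T-⇔⇒≡ {false} {true}  b⇔c = ⊥-elim (Equivalence.from b⇔c tt)
T-⇔⇒≡ {true}  {false} b⇔c = ⊥-elim (Equivalence.to b⇔c tt)
T-⇔⇒≡ {true}  {true}  _   = refl

T-isClosed : (t : Term n) → T (isClosed t) ⇔ Closed t
T-isClosed {n} t = mk⇔
  (λ h i → ≡ᵇ⇒≡ _ 0 (All.lookup (all⁺ absent (allFin n) h) (∈-allFin i)))
  (λ h → all⁻ absent {allFin n} (All.tabulate λ {i} _ → ≡⇒≡ᵇ _ 0 (h i)))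
  where
  absent : Fin n → Bool
  absent i = occ t i ≡ᵇ 0

occurs⇒Open : (t : Term n) (i : Fin n) → occ t i ≢ 0 → Open t
occurs⇒Open t i occ≢0 =
  Equivalence.from T-not⇔¬T λ closed → occ≢0 (Equivalence.to (T-isClosed t) closed i)

Closed⇒¬Open : (t : Term n) → Closed t → ¬ Open t
Closed⇒¬Open t closed t-open =
  Equivalence.to T-not⇔¬T t-open (Equivalence.from (T-isClosed t) closed)

Open-appˡ : (t u : Term n) → Open t → Open (app t u)
Open-appˡ t u t-open = Equivalence.from T-not⇔¬T λ closed →
  Closed⇒¬Open t (λ i → m+n≡0⇒m≡0 (occ t i) (Equivalence.to (T-isClosed (app t u)) closed i)) t-open

Open-appʳ : (t u : Term n) → Open u → Open (app t u)
Open-appʳ t u u-open = Equivalence.from T-not⇔¬T λ closed →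
  Closed⇒¬Open u (λ i → m+n≡0⇒n≡0 (occ t i) (Equivalence.to (T-isClosed (app t u)) closed i)) u-open

once⇒Open : (t : Term n) (i : Fin n) → occ t i ≡ 1 → Open t
once⇒Open t i once = occurs⇒Open t i λ absent → 1+n≢0 (trans (sym once) absent)

occ-var-self : (i : Fin n) → occ (var i) i ≡ 1
occ-var-self zero    = refl
occ-var-self (suc i) = occ-var-self i

occ-var-other : (j i : Fin n) → j ≢ i → occ (var j) i ≡ 0
occ-var-other zero    zero    j≢i = ⊥-elim (j≢i refl)
occ-var-other zero    (suc i) _   = refl
occ-var-other (suc j) zero    _   = refl
occ-var-other (suc j) (suc i) j≢i = occ-var-other j i (j≢i ∘ cong suc)

linear-app⁻ : (t u : Term n) → Linear (app t u) → Linear t × Linear u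
linear-app⁻ t u = Equivalence.to (T-∧ {isLinear t})

linear-lam⁻ : (t : Term (suc n)) → Linear (lam t) → occ t zero ≡ 1 × Linear t
linear-lam⁻ t h with Equivalence.to (T-∧ {occ t zero ≡ᵇ 1}) h
... | once , linear = ≡ᵇ⇒≡ _ 1 once , linear

noClosedProper-app⁻ : (t u : Term n) → NoClosedProper (app t u) →
                      NoClosedSubterm t × NoClosedSubterm u
noClosedProper-app⁻ t u h
  with isClosed t | isClosed u | noClosedProperSubterm t | noClosedProperSubterm u
... | false | false | true | true = (tt , tt) , (tt , tt)

noClosedProper-app⁺ : (t u : Term n) → NoClosedSubterm t → NoClosedSubterm u →
                      NoClosedProper (app t u)
noClosedProper-app⁺ t u ht hu
  with isClosed t | isClosed u | noClosedProperSubterm t | noClosedProperSubterm u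
... | false | false | true | true = tt

noClosedProper-lam⁻ : (t : Term (suc n)) → NoClosedProper (lam t) → NoClosedSubterm t
noClosedProper-lam⁻ t h with isClosed t | noClosedProperSubterm t
... | false | true = tt , tt

noClosedProper-lam⁺ : (t : Term (suc n)) → NoClosedSubterm t → NoClosedProper (lam t)
noClosedProper-lam⁺ t h with isClosed t | noClosedProperSubterm t
... | false | true = tt

NoClosedSubterm-app⁻ : (t u : Term n) → NoClosedSubterm (app t u) →
                       NoClosedSubterm t × NoClosedSubterm u
NoClosedSubterm-app⁻ t u = noClosedProper-app⁻ t u ∘ proj₂

NoClosedSubterm-lam⁻ : (t : Term (suc n)) → NoClosedSubterm (lam t) → NoClosedSubterm t
NoClosedSubterm-lam⁻ t = noClosedProper-lam⁻ t ∘ proj₂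

var-injective : {i j : Fin n} → var i ≡ var j → i ≡ j
var-injective refl = refl

app-injective : {t u t′ u′ : Term n} → app t u ≡ app t′ u′ → t ≡ t′ × u ≡ u′
app-injective refl = refl , refl

lam-injective : {t t′ : Term (suc n)} → lam t ≡ lam t′ → t ≡ t′
lam-injective refl = refl

rename : (Fin m → Fin n) → Term m → Term n
rename ρ (var i)   = var (ρ i)
rename ρ (app t u) = app (rename ρ t) (rename ρ u)
rename ρ (lam t)   = lam (rename (lift 1 ρ) t)

lift₁-injective : {ρ : Fin m → Fin n} → Injective _≡_ _≡_ ρ → Injective _≡_ _≡_ (lift 1 ρ)
lift₁-injective {ρ = ρ} ρ-inj = lift-injective ρ ρ-inj 1

∄-lift : {ρ : Fin m → Fin n} {j : Fin n} → ∄[ i ] ρ i ≡ j → ∄[ i ] lift 1 ρ i ≡ suc j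
∄-lift ∄i (suc i , e) = ∄i (i , fsuc-injective e)

∄-unlift : {ρ : Fin m → Fin n} {j : Fin n} → ∄[ i ] lift 1 ρ i ≡ suc j → ∄[ i ] ρ i ≡ j
∄-unlift ∄i (i , e) = ∄i (suc i , cong suc e)

size-rename : (ρ : Fin m → Fin n) (t : Term m) → size (rename ρ t) ≡ size t
size-rename ρ (var i)   = refl
size-rename ρ (app t u) = cong₂ (λ a b → suc (a + b)) (size-rename ρ t) (size-rename ρ u)
size-rename ρ (lam t)   = cong suc (size-rename (lift 1 ρ) t)

occ-rename : {ρ : Fin m → Fin n} → Injective _≡_ _≡_ ρ →
             (t : Term m) (i : Fin m) → occ (rename ρ t) (ρ i) ≡ occ t i
occ-rename {ρ = ρ} ρ-inj (var j) i with j ≟ i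
... | yes refl = trans (occ-var-self (ρ j)) (sym (occ-var-self j))
... | no j≢i   = trans (occ-var-other (ρ j) (ρ i) (j≢i ∘ ρ-inj)) (sym (occ-var-other j i j≢i))
occ-rename ρ-inj (app t u) i = cong₂ _+_ (occ-rename ρ-inj t i) (occ-rename ρ-inj u i)
occ-rename ρ-inj (lam t) i = occ-rename (lift₁-injective ρ-inj) t (suc i)

occ-rename-∉ : (ρ : Fin m → Fin n) (t : Term m) (j : Fin n) → ∄[ i ] ρ i ≡ j →
               occ (rename ρ t) j ≡ 0
occ-rename-∉ ρ (var i)   j ∄i = occ-var-other (ρ i) j (λ e → ∄i (i , e))
occ-rename-∉ ρ (app t u) j ∄i = cong₂ _+_ (occ-rename-∉ ρ t j ∄i) (occ-rename-∉ ρ u j ∄i)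
occ-rename-∉ ρ (lam t)   j ∄i = occ-rename-∉ (lift 1 ρ) t (suc j) (∄-lift ∄i)

Closed-rename : {ρ : Fin m → Fin n} → Injective _≡_ _≡_ ρ →
                (t : Term m) → Closed (rename ρ t) ⇔ Closed t
Closed-rename {ρ = ρ} ρ-inj t = mk⇔
  (λ closed i → trans (sym (occ-rename ρ-inj t i)) (closed (ρ i)))
  (λ closed j → from closed j (any? λ i → ρ i ≟ j))
  where
  from : Closed t → ∀ j → Dec (∃[ i ] ρ i ≡ j) → occ (rename ρ t) j ≡ 0
  from closed _ (yes (i , refl)) = trans (occ-rename ρ-inj t i) (closed i)
  from closed j (no ∄i)          = occ-rename-∉ ρ t j ∄i

isClosed-rename : {ρ : Fin m → Fin n} → Injective _≡_ _≡_ ρ →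
                  (t : Term m) → isClosed (rename ρ t) ≡ isClosed t
isClosed-rename ρ-inj t =
  T-⇔⇒≡ (⇔.trans (T-isClosed (rename _ t)) (⇔.trans (Closed-rename ρ-inj t) (⇔.sym (T-isClosed t))))

isLinear-rename : {ρ : Fin m → Fin n} → Injective _≡_ _≡_ ρ →
                  (t : Term m) → isLinear (rename ρ t) ≡ isLinear t
isLinear-rename ρ-inj (var i)   = refl
isLinear-rename ρ-inj (app t u) = cong₂ _∧_ (isLinear-rename ρ-inj t) (isLinear-rename ρ-inj u)
isLinear-rename ρ-inj (lam t) =
  cong₂ (λ o l → (o ≡ᵇ 1) ∧ l) (occ-rename (lift₁-injective ρ-inj) t zero)
                               (isLinear-rename (lift₁-injective ρ-inj) t)

noClosedProper-rename : {ρ : Fin m → Fin n} → Injective _≡_ _≡_ ρ →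
                        (t : Term m) → noClosedProperSubterm (rename ρ t) ≡ noClosedProperSubterm t
noClosedProper-rename ρ-inj (var i) = refl
noClosedProper-rename ρ-inj (app t u)
  rewrite isClosed-rename ρ-inj t | isClosed-rename ρ-inj u
        | noClosedProper-rename ρ-inj t | noClosedProper-rename ρ-inj u = refl
noClosedProper-rename ρ-inj (lam t)
  rewrite isClosed-rename (lift₁-injective ρ-inj) t
        | noClosedProper-rename (lift₁-injective ρ-inj) t = refl

NoClosedSubterm-rename : {ρ : Fin m → Fin n} → Injective _≡_ _≡_ ρ →
                         (t : Term m) → NoClosedSubterm (rename ρ t) ⇔ NoClosedSubterm t
NoClosedSubterm-rename ρ-inj t
  rewrite isClosed-rename ρ-inj t | noClosedProper-rename ρ-inj t = mk⇔ id id

rename-injective : {ρ : Fin m → Fin n} → Injective _≡_ _≡_ ρ →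
                   Injective _≡_ _≡_ (rename ρ)
rename-injective ρ-inj {var i}   {var j}   e = cong var (ρ-inj (var-injective e))
rename-injective ρ-inj {app t u} {app t′ u′} e =
  let et , eu = app-injective e in cong₂ app (rename-injective ρ-inj et) (rename-injective ρ-inj eu)
rename-injective ρ-inj {lam t} {lam t′} e =
  cong lam (rename-injective (lift₁-injective ρ-inj) (lam-injective e))
rename-injective ρ-inj {var _}   {app _ _} ()
rename-injective ρ-inj {var _}   {lam _}   ()
rename-injective ρ-inj {app _ _} {var _}   ()
rename-injective ρ-inj {app _ _} {lam _}   ()
rename-injective ρ-inj {lam _}   {var _}   ()
rename-injective ρ-inj {lam _}   {app _ _} ()

rename-preimage : (ρ : Fin m → Fin n) (t : Term n) →
                  (∀ j → ∄[ i ] ρ i ≡ j → occ t j ≡ 0) → ∃[ t′ ] rename ρ t′ ≡ t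
rename-preimage ρ (var j) outside with any? (λ i → ρ i ≟ j)
... | yes (i , ρi≡j) = var i , cong var ρi≡j
... | no ∄i          = ⊥-elim (1+n≢0 (trans (sym (occ-var-self j)) (outside j ∄i)))
rename-preimage ρ (app t u) outside
  with rename-preimage ρ t (λ j ∄i → m+n≡0⇒m≡0 (occ t j) (outside j ∄i))
     | rename-preimage ρ u (λ j ∄i → m+n≡0⇒n≡0 (occ t j) (outside j ∄i))
... | t′ , refl | u′ , refl = app t′ u′ , refl
rename-preimage ρ (lam t) outside =
  let t′ , e = rename-preimage (lift 1 ρ) t outside-lift in lam t′ , cong lam e
  where
  outside-lift : ∀ j → ∄[ i ] lift 1 ρ i ≡ j → occ t j ≡ 0
  outside-lift zero    ∄i = ⊥-elim (∄i (zero , refl))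
  outside-lift (suc j) ∄i = outside j (∄-unlift ∄i)

inject₁-or-fromℕ : (j : Fin (suc k)) → (∃[ i ] inject₁ i ≡ j) ⊎ j ≡ fromℕ k
inject₁-or-fromℕ {zero}  zero    = inj₂ refl
inject₁-or-fromℕ {suc k} zero    = inj₁ (zero , refl)
inject₁-or-fromℕ {suc k} (suc j) with inject₁-or-fromℕ j
... | inj₁ (i , refl) = inj₁ (suc i , refl)
... | inj₂ refl       = inj₂ refl

weaken : Term k → Term (suc k)
weaken = rename inject₁

embedOuter : ∀ k → Term 1 → Term (suc k)
embedOuter k = rename (λ _ → fromℕ k)

outer-injective : Injective _≡_ _≡_ (λ (_ : Fin 1) → fromℕ k)
outer-injective {x = zero} {zero} _ = refl

occ-weaken-inject₁ : (x : Term k) (i : Fin k) → occ (weaken x) (inject₁ i) ≡ occ x i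
occ-weaken-inject₁ = occ-rename inject₁-injective

occ-weaken-fromℕ : (x : Term k) → occ (weaken x) (fromℕ k) ≡ 0
occ-weaken-fromℕ x = occ-rename-∉ inject₁ x _ λ (_ , e) → fromℕ≢inject₁ (sym e)

occ-embedOuter-fromℕ : (u : Term 1) → occ (embedOuter k u) (fromℕ k) ≡ occ u zero
occ-embedOuter-fromℕ u = occ-rename outer-injective u zero

occ-embedOuter-inject₁ : (u : Term 1) (i : Fin k) → occ (embedOuter k u) (inject₁ i) ≡ 0
occ-embedOuter-inject₁ u i = occ-rename-∉ _ u (inject₁ i) λ (_ , e) → fromℕ≢inject₁ e

isLinear-weaken : (x : Term k) → isLinear (weaken x) ≡ isLinear x
isLinear-weaken = isLinear-rename inject₁-injective

isLinear-embedOuter : ∀ k (u : Term 1) → isLinear (embedOuter k u) ≡ isLinear u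
isLinear-embedOuter k = isLinear-rename (outer-injective {k})

NoClosedSubterm-weaken : (x : Term k) → NoClosedSubterm (weaken x) ⇔ NoClosedSubterm x
NoClosedSubterm-weaken = NoClosedSubterm-rename inject₁-injective

noClosedProper-embedOuter : ∀ k (u : Term 1) →
                            noClosedProperSubterm (embedOuter k u) ≡ noClosedProperSubterm u
noClosedProper-embedOuter k = noClosedProper-rename (outer-injective {k})

weaken-injective : {x x′ : Term k} → weaken x ≡ weaken x′ → x ≡ x′
weaken-injective = rename-injective inject₁-injective

embedOuter-injective : {u u′ : Term 1} → embedOuter k u ≡ embedOuter k u′ → u ≡ u′
embedOuter-injective {k} = rename-injective (outer-injective {k})

weaken-preimage : (t : Term (suc k)) → occ t (fromℕ k) ≡ 0 → ∃[ x ] weaken x ≡ t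
weaken-preimage t outer-absent =
  rename-preimage inject₁ t λ j ∄i → case j (inject₁-or-fromℕ j) ∄i
  where
  case : ∀ j → (∃[ i ] inject₁ i ≡ j) ⊎ j ≡ fromℕ _ → ∄[ i ] inject₁ i ≡ j → occ t j ≡ 0
  case _ (inj₁ i)    ∄i = ⊥-elim (∄i i)
  case _ (inj₂ refl) _  = outer-absent

embedOuter-preimage : (t : Term (suc k)) → (∀ i → occ t (inject₁ i) ≡ 0) →
                      ∃[ u ] embedOuter k u ≡ t
embedOuter-preimage t inner-absent =
  rename-preimage _ t λ j ∄i → case j (inject₁-or-fromℕ j) ∄i
  where
  case : ∀ j → (∃[ i ] inject₁ i ≡ j) ⊎ j ≡ fromℕ _ → ∄[ i ] fromℕ _ ≡ j → occ t j ≡ 0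
  case _ (inj₁ (i , refl)) _ = inner-absent i
  case _ (inj₂ refl)       ∄i = ⊥-elim (∄i (zero , refl))

data Pos : Term n → Set where
  here  : {t : Term n} → Pos t
  inL   : {t u : Term n} → Pos t → Pos (app t u)
  inR   : {t u : Term n} → Pos u → Pos (app t u)
  under : {t : Term (suc n)} → Pos t → Pos (lam t)

attach : Bool → Term n → Term n → Term n
attach true  w e = app w e
attach false w e = app e w

-- graft x p u b applies the subterm of x at p to u (or u to it, when b is false),
-- binding the variable of u by a new outermost binder: x keeps its indices and
-- the variable of u becomes fromℕ k.
graft : (x : Term k) → Pos x → Term 1 → Bool → Term (suc k)
graft {k} x           here      u b = attach b (weaken x) (embedOuter k u)
graft     (app x₁ x₂) (inL p)   u b = app (graft x₁ p u b) (weaken x₂)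
graft     (app x₁ x₂) (inR p)   u b = app (weaken x₁) (graft x₂ p u b)
graft     (lam x)     (under p) u b = lam (graft x p u b)

size-graft : (x : Term k) (p : Pos x) (u : Term 1) (b : Bool) →
             size (graft x p u b) ≡ suc (size x + size u)
size-graft {k} x here u true
  rewrite size-rename inject₁ x | size-rename (λ _ → fromℕ k) u = refl
size-graft {k} x here u false
  rewrite size-rename inject₁ x | size-rename (λ _ → fromℕ k) u =
  cong suc (+-comm (size u) (size x))
size-graft (app x₁ x₂) (inL p) u b
  rewrite size-graft x₁ p u b | size-rename inject₁ x₂ =
  cong (λ s → suc (suc s)) (+-Properties.xy∙z≈xz∙y (size x₁) (size u) (size x₂))
size-graft (app x₁ x₂) (inR p) u b
  rewrite size-graft x₂ p u b | size-rename inject₁ x₁ =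
  cong suc (trans (+-suc (size x₁) _) (cong suc (sym (+-assoc (size x₁) (size x₂) (size u)))))
size-graft (lam x) (under p) u b = cong suc (size-graft x p u b)

occ-graft-inject₁ : (x : Term k) (p : Pos x) (u : Term 1) (b : Bool) (i : Fin k) →
                    occ (graft x p u b) (inject₁ i) ≡ occ x i
occ-graft-inject₁ {k} x here u true i
  rewrite occ-weaken-inject₁ x i | occ-embedOuter-inject₁ {k} u i = +-identityʳ (occ x i)
occ-graft-inject₁ {k} x here u false i
  rewrite occ-weaken-inject₁ x i | occ-embedOuter-inject₁ {k} u i = refl
occ-graft-inject₁ (app x₁ x₂) (inL p) u b i
  rewrite occ-graft-inject₁ x₁ p u b i | occ-weaken-inject₁ x₂ i = refl
occ-graft-inject₁ (app x₁ x₂) (inR p) u b i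
  rewrite occ-graft-inject₁ x₂ p u b i | occ-weaken-inject₁ x₁ i = refl
occ-graft-inject₁ (lam x) (under p) u b i = occ-graft-inject₁ x p u b (suc i)

occ-graft-fromℕ : (x : Term k) (p : Pos x) (u : Term 1) (b : Bool) →
                  occ (graft x p u b) (fromℕ k) ≡ occ u zero
occ-graft-fromℕ {k} x here u true
  rewrite occ-weaken-fromℕ x | occ-embedOuter-fromℕ {k} u = refl
occ-graft-fromℕ {k} x here u false
  rewrite occ-weaken-fromℕ x | occ-embedOuter-fromℕ {k} u = +-identityʳ (occ u zero)
occ-graft-fromℕ (app x₁ x₂) (inL p) u b
  rewrite occ-graft-fromℕ x₁ p u b | occ-weaken-fromℕ x₂ = +-identityʳ (occ u zero)
occ-graft-fromℕ (app x₁ x₂) (inR p) u b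
  rewrite occ-graft-fromℕ x₂ p u b | occ-weaken-fromℕ x₁ = refl
occ-graft-fromℕ (lam x) (under p) u b = occ-graft-fromℕ x p u b

isLinear-graft : (x : Term k) (p : Pos x) (u : Term 1) (b : Bool) →
                 isLinear (graft x p u b) ≡ isLinear x ∧ isLinear u
isLinear-graft {k} x here u true
  rewrite isLinear-weaken x | isLinear-embedOuter k u = refl
isLinear-graft {k} x here u false
  rewrite isLinear-weaken x | isLinear-embedOuter k u =
  ∧-comm (isLinear u) (isLinear x)
isLinear-graft (app x₁ x₂) (inL p) u b
  rewrite isLinear-graft x₁ p u b | isLinear-weaken x₂ =
  ∧-Properties.xy∙z≈xz∙y (isLinear x₁) (isLinear u) (isLinear x₂)
isLinear-graft (app x₁ x₂) (inR p) u b
  rewrite isLinear-graft x₂ p u b | isLinear-weaken x₁ =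
  sym (∧-assoc (isLinear x₁) (isLinear x₂) (isLinear u))
isLinear-graft (lam x) (under p) u b
  rewrite isLinear-graft x p u b | occ-graft-inject₁ x p u b zero =
  sym (∧-assoc (occ x zero ≡ᵇ 1) (isLinear x) (isLinear u))

NoClosedSubterm-embedOuter : ∀ k (u : Term 1) → occ u zero ≡ 1 → NoClosedProper u →
                             NoClosedSubterm (embedOuter k u)
NoClosedSubterm-embedOuter k u once u-ncp =
  once⇒Open (embedOuter k u) (fromℕ k) (trans (occ-embedOuter-fromℕ u) once) ,
  subst T (sym (noClosedProper-embedOuter k u)) u-ncp

noClosedProper-attach : (b : Bool) (w e : Term n) → NoClosedSubterm w → NoClosedSubterm e →
                        NoClosedProper (attach b w e)
noClosedProper-attach true  w e hw he = noClosedProper-app⁺ w e hw he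
noClosedProper-attach false w e hw he = noClosedProper-app⁺ e w he hw

NoClosedSubterm-graft : (x : Term k) (p : Pos x) (u : Term 1) (b : Bool) →
                        NoClosedSubterm x → occ u zero ≡ 1 → NoClosedProper u →
                        NoClosedSubterm (graft x p u b)
noClosedProper-graft : (x : Term k) (p : Pos x) (u : Term 1) (b : Bool) →
                       NoClosedSubterm x → occ u zero ≡ 1 → NoClosedProper u →
                       NoClosedProper (graft x p u b)

NoClosedSubterm-graft x p u b hx once hu =
  once⇒Open (graft x p u b) (fromℕ _) (trans (occ-graft-fromℕ x p u b) once) ,
  noClosedProper-graft x p u b hx once hu

noClosedProper-graft {k} x here u b hx once hu =
  noClosedProper-attach b (weaken x) (embedOuter k u)
    (Equivalence.from (NoClosedSubterm-weaken x) hx) (NoClosedSubterm-embedOuter k u once hu)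
noClosedProper-graft (app x₁ x₂) (inL p) u b hx once hu =
  let h₁ , h₂ = NoClosedSubterm-app⁻ x₁ x₂ hx in
  noClosedProper-app⁺ (graft x₁ p u b) (weaken x₂) (NoClosedSubterm-graft x₁ p u b h₁ once hu)
                                                 (Equivalence.from (NoClosedSubterm-weaken x₂) h₂)
noClosedProper-graft (app x₁ x₂) (inR p) u b hx once hu =
  let h₁ , h₂ = NoClosedSubterm-app⁻ x₁ x₂ hx in
  noClosedProper-app⁺ (weaken x₁) (graft x₂ p u b) (Equivalence.from (NoClosedSubterm-weaken x₁) h₁)
                                                 (NoClosedSubterm-graft x₂ p u b h₂ once hu)
noClosedProper-graft (lam x) (under p) u b hx once hu =
  noClosedProper-lam⁺ (graft x p u b)
    (NoClosedSubterm-graft x p u b (NoClosedSubterm-lam⁻ x hx) once hu)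

record Decomposition (r : Term (suc k)) : Set where
  constructor decomposition
  field
    host  : Term k
    pos   : Pos host
    guest : Term 1
    side  : Bool
    grafts-to             : graft host pos guest side ≡ r
    host-noClosedSubterm  : NoClosedSubterm host
    guest-noClosedProper  : NoClosedProper guest

decomposition-under : (r : Term (suc (suc k))) → Decomposition r →
                      ∃[ i ] occ (lam r) (inject₁ i) ≢ 0 → Decomposition (lam r)
decomposition-under _ (decomposition x p u b refl hx hu) (i , occurs) =
  decomposition (lam x) (under p) u b refl (x-open , noClosedProper-lam⁺ x hx) hu
  where
  x-open : Open (lam x)
  x-open = occurs⇒Open (lam x) i (occurs ∘ trans (occ-graft-inject₁ x p u b (suc i)))

-- The last hypothesis (a variable other than fromℕ k occurs in r) is what makes the host
-- open; it fails exactly when r is the embedded guest itself.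
decompose : (r : Term (suc k)) → occ r (fromℕ k) ≡ 1 → Linear r → NoClosedProper r →
            ∃[ i ] occ r (inject₁ i) ≢ 0 → Decomposition r
decompose-operand : (s : Term (suc k)) → occ s (fromℕ k) ≡ 1 → Linear s → NoClosedProper s →
                    (∃[ u ] embedOuter k u ≡ s) ⊎ Decomposition s

decompose-operand {k} s once lin ncp with all? (λ i → occ s (inject₁ i) ℕ.≟ 0)
... | yes absent = inj₁ (embedOuter-preimage s absent)
... | no ¬absent =
  inj₂ (decompose s once lin ncp (¬∀⟶∃¬ k _ (λ i → occ s (inject₁ i) ℕ.≟ 0) ¬absent))

decompose {k} (var j) once _ _ (i , occurs) with j ≟ fromℕ k
... | yes refl = ⊥-elim (occurs (occ-var-other (fromℕ k) (inject₁ i) fromℕ≢inject₁))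
... | no j≢y   = ⊥-elim (1+n≢0 (trans (sym once) (occ-var-other j (fromℕ k) j≢y)))
decompose (lam r) once lin ncp occurs =
  let once₀ , lin′ = linear-lam⁻ r lin in
  decomposition-under r
    (decompose r once lin′ (proj₂ (noClosedProper-lam⁻ r ncp))
               (zero , λ e → 1+n≢0 (trans (sym once₀) e)))
    occurs
decompose {k} (app a c) once lin ncp _
  with m+n≡1-cases (occ a (fromℕ k)) (occ c (fromℕ k)) once
     | linear-app⁻ a c lin | noClosedProper-app⁻ a c ncp
... | inj₁ (a-absent , c-once) | _ , c-lin | a-ncs , c-ncs
  with weaken-preimage a a-absent | decompose-operand c c-once c-lin (proj₂ c-ncs)
...   | a′ , refl | inj₁ (u , refl) =
  decomposition a′ here u true refl (Equivalence.to (NoClosedSubterm-weaken a′) a-ncs)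
    (subst T (noClosedProper-embedOuter k u) (proj₂ c-ncs))
...   | a′ , refl | inj₂ (decomposition x p u b refl hx hu) =
  let a′-ncs = Equivalence.to (NoClosedSubterm-weaken a′) a-ncs in
  decomposition (app a′ x) (inR p) u b refl
    (Open-appˡ a′ x (proj₁ a′-ncs) , noClosedProper-app⁺ a′ x a′-ncs hx) hu
decompose {k} (app a c) once lin ncp _
    | inj₂ (a-once , c-absent) | a-lin , _ | a-ncs , c-ncs
  with weaken-preimage c c-absent | decompose-operand a a-once a-lin (proj₂ a-ncs)
...   | c′ , refl | inj₁ (u , refl) =
  decomposition c′ here u false refl (Equivalence.to (NoClosedSubterm-weaken c′) c-ncs)
    (subst T (noClosedProper-embedOuter k u) (proj₂ a-ncs))
...   | c′ , refl | inj₂ (decomposition x p u b refl hx hu) =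
  let c′-ncs = Equivalence.to (NoClosedSubterm-weaken c′) c-ncs in
  decomposition (app x c′) (inL p) u b refl
    (Open-appʳ x c′ (proj₁ c′-ncs) , noClosedProper-app⁺ x c′ hx c′-ncs) hu

GraftData : ℕ → Set
GraftData k = Σ[ x ∈ Term k ] Pos x × Term 1 × Bool

weaken≢outer-once : (x : Term k) (t : Term (suc k)) → occ t (fromℕ k) ≡ 1 → weaken x ≢ t
weaken≢outer-once x t once refl = 1+n≢0 (trans (sym once) (occ-weaken-fromℕ x))

weaken≢embedOuter : (x : Term k) (u : Term 1) → occ u zero ≡ 1 → weaken x ≢ embedOuter k u
weaken≢embedOuter x u once = weaken≢outer-once x _ (trans (occ-embedOuter-fromℕ u) once)

weaken≢graft : (x x′ : Term k) (p′ : Pos x′) (u′ : Term 1) (b′ : Bool) → occ u′ zero ≡ 1 →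
               weaken x ≢ graft x′ p′ u′ b′
weaken≢graft x x′ p′ u′ b′ once = weaken≢outer-once x _ (trans (occ-graft-fromℕ x′ p′ u′ b′) once)

embedOuter≢graft : (u : Term 1) (x′ : Term k) (p′ : Pos x′) (u′ : Term 1) (b′ : Bool) → Open x′ →
                   embedOuter k u ≢ graft x′ p′ u′ b′
embedOuter≢graft u x′ p′ u′ b′ x′-open e = Closed⇒¬Open x′ x′-closed x′-open
  where
  x′-closed : Closed x′
  x′-closed i = begin
    occ x′ i                               ≡⟨ occ-graft-inject₁ x′ p′ u′ b′ i ⟨
    occ (graft x′ p′ u′ b′) (inject₁ i)    ≡⟨ cong (λ t → occ t (inject₁ i)) e ⟨
    occ (embedOuter _ u) (inject₁ i)       ≡⟨ occ-embedOuter-inject₁ u i ⟩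
    0                                      ∎
    where open ≡-Reasoning

here≢inL : (x : Term k) (u : Term 1) (b : Bool) (x₁ x₂ : Term k) (q : Pos x₁) (u′ : Term 1)
           (b′ : Bool) → occ u zero ≡ 1 → Open x₁ →
           graft x here u b ≢ graft (app x₁ x₂) (inL q) u′ b′
here≢inL x u true  x₁ x₂ q u′ b′ once _ e =
  weaken≢embedOuter x₂ u once (sym (proj₂ (app-injective e)))
here≢inL x u false x₁ x₂ q u′ b′ _ x₁-open e =
  embedOuter≢graft u x₁ q u′ b′ x₁-open (proj₁ (app-injective e))

here≢inR : (x : Term k) (u : Term 1) (b : Bool) (x₁ x₂ : Term k) (q : Pos x₂) (u′ : Term 1)
           (b′ : Bool) → occ u zero ≡ 1 → Open x₂ →
           graft x here u b ≢ graft (app x₁ x₂) (inR q) u′ b′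
here≢inR x u true  x₁ x₂ q u′ b′ _ x₂-open e =
  embedOuter≢graft u x₂ q u′ b′ x₂-open (proj₂ (app-injective e))
here≢inR x u false x₁ x₂ q u′ b′ once _ e =
  weaken≢embedOuter x₁ u once (sym (proj₁ (app-injective e)))

here≢under : (x : Term k) (u : Term 1) (b : Bool) (x₁ : Term (suc k)) (q : Pos x₁) (u′ : Term 1)
             (b′ : Bool) → graft x here u b ≢ graft (lam x₁) (under q) u′ b′
here≢under x u true  x₁ q u′ b′ ()
here≢under x u false x₁ q u′ b′ ()

graft-here-injective : (x x′ : Term k) (u u′ : Term 1) (b b′ : Bool) →
                       occ u zero ≡ 1 → occ u′ zero ≡ 1 → graft x here u b ≡ graft x′ here u′ b′ →
                       _≡_ {A = GraftData k} (x , here , u , b) (x′ , here , u′ , b′)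
graft-here-injective x x′ u u′ true true _ _ e
  with refl ← weaken-injective (proj₁ (app-injective e))
     | refl ← embedOuter-injective (proj₂ (app-injective e)) = refl
graft-here-injective x x′ u u′ false false _ _ e
  with refl ← weaken-injective (proj₂ (app-injective e))
     | refl ← embedOuter-injective (proj₁ (app-injective e)) = refl
graft-here-injective x x′ u u′ true false _ once′ e =
  ⊥-elim (weaken≢embedOuter x u′ once′ (proj₁ (app-injective e)))
graft-here-injective x x′ u u′ false true once _ e =
  ⊥-elim (weaken≢embedOuter x′ u once (sym (proj₁ (app-injective e))))

graft-injective : (x x′ : Term k) (p : Pos x) (p′ : Pos x′) (u u′ : Term 1) (b b′ : Bool) →
                  NoClosedSubterm x → NoClosedSubterm x′ → occ u zero ≡ 1 → occ u′ zero ≡ 1 →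
                  graft x p u b ≡ graft x′ p′ u′ b′ →
                  _≡_ {A = GraftData k} (x , p , u , b) (x′ , p′ , u′ , b′)
graft-injective x x′ here here u u′ b b′ _ _ once once′ =
  graft-here-injective x x′ u u′ b b′ once once′
graft-injective x (app x₁ x₂) here (inL q) u u′ b b′ _ hx′ once _ e =
  ⊥-elim (here≢inL x u b x₁ x₂ q u′ b′ once (proj₁ (proj₁ (NoClosedSubterm-app⁻ x₁ x₂ hx′))) e)
graft-injective x (app x₁ x₂) here (inR q) u u′ b b′ _ hx′ once _ e =
  ⊥-elim (here≢inR x u b x₁ x₂ q u′ b′ once (proj₁ (proj₂ (NoClosedSubterm-app⁻ x₁ x₂ hx′))) e)
graft-injective x (lam x₁) here (under q) u u′ b b′ _ _ _ _ e =
  ⊥-elim (here≢under x u b x₁ q u′ b′ e)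
graft-injective (app x₁ x₂) x′ (inL q) here u u′ b b′ hx _ _ once′ e =
  ⊥-elim (here≢inL x′ u′ b′ x₁ x₂ q u b once′ (proj₁ (proj₁ (NoClosedSubterm-app⁻ x₁ x₂ hx)))
    (sym e))
graft-injective (app x₁ x₂) x′ (inR q) here u u′ b b′ hx _ _ once′ e =
  ⊥-elim (here≢inR x′ u′ b′ x₁ x₂ q u b once′ (proj₁ (proj₂ (NoClosedSubterm-app⁻ x₁ x₂ hx)))
    (sym e))
graft-injective (lam x₁) x′ (under q) here u u′ b b′ _ _ _ _ e =
  ⊥-elim (here≢under x′ u′ b′ x₁ q u b (sym e))
graft-injective (app x₁ x₂) (app y₁ y₂) (inL q) (inL q′) u u′ b b′ hx hy once once′ e
  with graft-injective x₁ y₁ q q′ u u′ b b′ (proj₁ (NoClosedSubterm-app⁻ x₁ x₂ hx))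
         (proj₁ (NoClosedSubterm-app⁻ y₁ y₂ hy)) once once′ (proj₁ (app-injective e))
... | refl rewrite weaken-injective (proj₂ (app-injective e)) = refl
graft-injective (app x₁ x₂) (app y₁ y₂) (inR q) (inR q′) u u′ b b′ hx hy once once′ e
  with graft-injective x₂ y₂ q q′ u u′ b b′ (proj₂ (NoClosedSubterm-app⁻ x₁ x₂ hx))
         (proj₂ (NoClosedSubterm-app⁻ y₁ y₂ hy)) once once′ (proj₂ (app-injective e))
... | refl rewrite weaken-injective (proj₁ (app-injective e)) = refl
graft-injective (app x₁ x₂) (app y₁ y₂) (inL q) (inR q′) u u′ b b′ _ _ _ once′ e =
  ⊥-elim (weaken≢graft x₂ y₂ q′ u′ b′ once′ (proj₂ (app-injective e)))
graft-injective (app x₁ x₂) (app y₁ y₂) (inR q) (inL q′) u u′ b b′ _ _ once _ e =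
  ⊥-elim (weaken≢graft y₂ x₂ q u b once (sym (proj₂ (app-injective e))))
graft-injective (lam x) (lam y) (under q) (under q′) u u′ b b′ hx hy once once′ e
  with graft-injective x y q q′ u u′ b b′ (NoClosedSubterm-lam⁻ x hx)
         (NoClosedSubterm-lam⁻ y hy) once once′ (lam-injective e)
... | refl = refl

NonRootPos : Term n → Set
NonRootPos (var _)   = ⊥
NonRootPos (app t u) = Pos t ⊎ Pos u
NonRootPos (lam t)   = Pos t

NonRootPointed : ℕ → Set
NonRootPointed c = Σ[ V ∈ BTerm c ] NonRootPos (proj₁ V)

Splitting : ℕ → Set
Splitting m = Σ[ a ∈ ℕ ] Σ[ c ∈ ℕ ] a + c ≡ m

Convolution : (ℕ → Set) → (ℕ → Set) → ℕ → Set
Convolution A C m = Σ[ s ∈ Splitting m ] A (proj₁ s) × C (proj₁ (proj₂ s))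

BTerm-≡ : (V W : BTerm n) → proj₁ V ≡ proj₁ W → V ≡ W
BTerm-≡ (t , s , l , c) (.t , s′ , l′ , c′) refl
  rewrite ≡-irrelevant s s′ | T-irrelevant l l′ | T-irrelevant c c′ = refl

module _ (x : Term 1) (p : Pos x) (u : Term 1) (b : Bool) where

  size-λλgraft : size (lam (lam (graft x p u b))) ≡ suc (size (lam u) + size (lam x))
  size-λλgraft rewrite size-graft x p u b =
    cong (λ s → suc (suc s))
         (trans (cong suc (+-comm (size x) (size u))) (sym (+-suc (size u) (size x))))

  isLinear-λλgraft : isLinear (lam (lam (graft x p u b))) ≡ isLinear (lam x) ∧ isLinear (lam u)
  isLinear-λλgraft
    rewrite occ-graft-fromℕ x p u b | occ-graft-inject₁ x p u b zero | isLinear-graft x p u b =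
    trans (cong ((occ u zero ≡ᵇ 1) ∧_) (sym (∧-assoc (occ x zero ≡ᵇ 1) (isLinear x) (isLinear u))))
          (∧-Properties.x∙yz≈y∙xz (occ u zero ≡ᵇ 1) (isLinear (lam x)) (isLinear u))

  noClosedProper-λλgraft : Linear (lam u) → NoClosedProper (lam u) → NoClosedProper (lam x) →
                           NoClosedProper (lam (lam (graft x p u b)))
  noClosedProper-λλgraft lu nu nx =
    noClosedProper-lam⁺ (lam g) (once⇒Open (lam g) zero (trans (occ-graft-fromℕ x p u b) u-once) ,
      noClosedProper-lam⁺ g (NoClosedSubterm-graft x p u b (noClosedProper-lam⁻ x nx) u-once
        (proj₂ (noClosedProper-lam⁻ u nu))))
    where
    g = graft x p u b
    u-once = proj₁ (linear-lam⁻ u lu)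

-- The Bool records the side of the application on which the guest sits: the factor 2.
BGraftData : ℕ → Set
BGraftData m = Bool × Convolution BTerm NonRootPointed m

assemble : BGraftData m → BTerm (suc m)
assemble (_ , (_ , _ , _) , (var () , _) , _)
assemble (_ , (_ , _ , _) , (app _ _ , _ , _ , ()) , _)
assemble (_ , (_ , _ , _) , (lam _ , _) , (var () , _) , _)
assemble (_ , (_ , _ , _) , (lam _ , _) , (app _ _ , _ , _ , ()) , _)
assemble (b , (_ , _ , e) , (lam u , refl , lu , nu) , (lam x , refl , lx , nx) , p) =
  lam (lam (graft x p u b)) ,
  trans (size-λλgraft x p u b) (cong suc e) ,
  subst T (sym (isLinear-λλgraft x p u b)) (Equivalence.from T-∧ (lx , lu)) ,
  noClosedProper-λλgraft x p u b lu nu nx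

decompose-λλ : (r : Term 2) → Linear (lam (lam r)) → NoClosedProper (lam (lam r)) → Decomposition r
decompose-λλ r lin ncp =
  let once₁ , lin₁ = linear-lam⁻ (lam r) lin
      once₀ , lin₀ = linear-lam⁻ r lin₁
  in decompose r once₁ lin₀ (proj₂ (noClosedProper-lam⁻ r (proj₂ (noClosedProper-lam⁻ (lam r) ncp))))
       (zero , λ absent → 1+n≢0 (trans (sym once₀) absent))

ungraft : (r : Term 2) → Decomposition r → size (lam (lam r)) ≡ suc m → Linear (lam (lam r)) →
          BGraftData m
ungraft _ (decomposition x p u b refl hx hu) s lin =
  let lx , lu = Equivalence.to T-∧ (subst T (isLinear-λλgraft x p u b) lin) in
  b , (_ , _ , suc-injective (trans (sym (size-λλgraft x p u b)) s)) ,
  (lam u , refl , lu , noClosedProper-lam⁺ u (once⇒Open u zero (proj₁ (linear-lam⁻ u lu)) , hu)) ,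
  (lam x , refl , lx , noClosedProper-lam⁺ x hx) , p

-- The bound variable occurs in only one of t and u, so the other one is a closed proper subterm.
lam-app-¬NoClosedProper : (t u : Term 1) → Linear (lam (app t u)) → ¬ NoClosedProper (lam (app t u))
lam-app-¬NoClosedProper t u lin ncp
  with m+n≡1-cases (occ t zero) (occ u zero) (proj₁ (linear-lam⁻ (app t u) lin))
     | noClosedProper-app⁻ t u (proj₂ (noClosedProper-lam⁻ (app t u) ncp))
... | inj₁ (t-absent , _) | (t-open , _) , _ = Closed⇒¬Open t (λ { zero → t-absent }) t-open
... | inj₂ (_ , u-absent) | _ , (u-open , _) = Closed⇒¬Open u (λ { zero → u-absent }) u-open

disassemble : BTerm (suc m) → (m ≡ 1) ⊎ BGraftData m
disassemble (var () , _)
disassemble (app _ _ , _ , _ , ())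
disassemble (lam (var zero) , s , _)        = inj₁ (sym (suc-injective s))
disassemble (lam (app t u) , _ , lin , ncp) = ⊥-elim (lam-app-¬NoClosedProper t u lin ncp)
disassemble (lam (lam r) , s , lin , ncp)   = inj₂ (ungraft r (decompose-λλ r lin ncp) s lin)

assemble-ungraft : (r : Term 2) (d : Decomposition r) (s : size (lam (lam r)) ≡ suc m)
                   (lin : Linear (lam (lam r))) → proj₁ (assemble (ungraft r d s lin)) ≡ lam (lam r)
assemble-ungraft _ (decomposition _ _ _ _ refl _ _) _ _ = refl

BGraftData-≡ : {b : Bool} {u x : Term 1} {p : Pos x} (e e′ : suc (size u) + suc (size x) ≡ m)
               {lu lu′ : Linear (lam u)} {nu nu′ : NoClosedProper (lam u)}
               {lx lx′ : Linear (lam x)} {nx nx′ : NoClosedProper (lam x)} →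
               _≡_ {A = BGraftData m}
                 (b , (_ , _ , e)  , (lam u , refl , lu  , nu ) , (lam x , refl , lx  , nx ) , p)
                 (b , (_ , _ , e′) , (lam u , refl , lu′ , nu′) , (lam x , refl , lx′ , nx′) , p)
BGraftData-≡ e e′ {lu} {lu′} {nu} {nu′} {lx} {lx′} {nx} {nx′}
  rewrite ≡-irrelevant e e′ | T-irrelevant lu lu′ | T-irrelevant nu nu′
        | T-irrelevant lx lx′ | T-irrelevant nx nx′ = refl

guest-once : (x x′ : Term k) (p : Pos x) (p′ : Pos x′) (u u′ : Term 1) (b b′ : Bool) →
             graft x p u b ≡ graft x′ p′ u′ b′ → occ u zero ≡ 1 → occ u′ zero ≡ 1
guest-once x x′ p p′ u u′ b b′ e once = begin
  occ u′ zero                          ≡⟨ occ-graft-fromℕ x′ p′ u′ b′ ⟨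
  occ (graft x′ p′ u′ b′) (fromℕ _)    ≡⟨ cong (λ t → occ t (fromℕ _)) e ⟨
  occ (graft x p u b) (fromℕ _)        ≡⟨ occ-graft-fromℕ x p u b ⟩
  occ u zero                           ≡⟨ once ⟩
  1                                    ∎
  where open ≡-Reasoning

ungraft-graft : (x : Term 1) (p : Pos x) (u : Term 1) (b : Bool)
                (d : Decomposition (graft x p u b))
                (s : size (lam (lam (graft x p u b))) ≡ suc m)
                (lin : Linear (lam (lam (graft x p u b))))
                (e : suc (size u) + suc (size x) ≡ m)
                (lu : Linear (lam u)) (nu : NoClosedProper (lam u))
                (lx : Linear (lam x)) (nx : NoClosedProper (lam x)) →
                ungraft _ d s lin ≡
                (b , (_ , _ , e) , (lam u , refl , lu , nu) , (lam x , refl , lx , nx) , p)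
ungraft-graft x p u b (decomposition x′ p′ u′ b′ g hx′ hu′) s lin e lu nu lx nx
  with u-once ← proj₁ (linear-lam⁻ u lu)
  with graft-injective x′ x p′ p u′ u b′ b hx′ (noClosedProper-lam⁻ x nx)
         (guest-once x x′ p p′ u u′ b b′ (sym g) u-once) u-once g
... | refl with refl ← g = BGraftData-≡ _ e

identity-or-assemble : (m ≡ 1) ⊎ BGraftData m → BTerm (suc m)
identity-or-assemble (inj₁ refl) = lam (var zero) , refl , tt , tt
identity-or-assemble (inj₂ g)    = assemble g

disassemble-assemble : (g : (m ≡ 1) ⊎ BGraftData m) → disassemble (identity-or-assemble g) ≡ g
disassemble-assemble (inj₁ refl) = refl
disassemble-assemble (inj₂ (_ , (_ , _ , _) , (var () , _) , _))
disassemble-assemble (inj₂ (_ , (_ , _ , _) , (app _ _ , _ , _ , ()) , _))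
disassemble-assemble (inj₂ (_ , (_ , _ , _) , (lam _ , _) , (var () , _) , _))
disassemble-assemble (inj₂ (_ , (_ , _ , _) , (lam _ , _) , (app _ _ , _ , _ , ()) , _))
disassemble-assemble
  (inj₂ (b , (_ , _ , e) , (lam u , refl , lu , nu) , (lam x , refl , lx , nx) , p)) =
  cong inj₂ (ungraft-graft x p u b _ _ _ e lu nu lx nx)

assemble-disassemble : (V : BTerm (suc m)) → identity-or-assemble (disassemble V) ≡ V
assemble-disassemble (var () , _)
assemble-disassemble (app _ _ , _ , _ , ())
assemble-disassemble (lam (var zero) , refl , _ , _) = refl
assemble-disassemble (lam (app t u) , _ , lin , ncp) = ⊥-elim (lam-app-¬NoClosedProper t u lin ncp)
assemble-disassemble (lam (lam r) , s , lin , ncp) =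
  BTerm-≡ _ _ (assemble-ungraft r (decompose-λλ r lin ncp) s lin)

BTerm-suc↔ : BTerm (suc m) ↔ ((m ≡ 1) ⊎ BGraftData m)
BTerm-suc↔ = mk↔ₛ′ disassemble identity-or-assemble disassemble-assemble assemble-disassemble

Pos↔⊤⊎NonRootPos : (t : Term n) → Pos t ↔ (⊤ ⊎ NonRootPos t)
Pos↔⊤⊎NonRootPos (var i) =
  mk↔ₛ′ (λ { here → inj₁ tt }) (λ { (inj₁ tt) → here }) (λ { (inj₁ tt) → refl }) (λ { here → refl })
Pos↔⊤⊎NonRootPos (app t u) =
  mk↔ₛ′ (λ { here → inj₁ tt ; (inL p) → inj₂ (inj₁ p) ; (inR p) → inj₂ (inj₂ p) })
        (λ { (inj₁ tt) → here ; (inj₂ (inj₁ p)) → inL p ; (inj₂ (inj₂ p)) → inR p })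
        (λ { (inj₁ tt) → refl ; (inj₂ (inj₁ p)) → refl ; (inj₂ (inj₂ p)) → refl })
        (λ { here → refl ; (inL p) → refl ; (inR p) → refl })
Pos↔⊤⊎NonRootPos (lam t) =
  mk↔ₛ′ (λ { here → inj₁ tt ; (under p) → inj₂ p }) (λ { (inj₁ tt) → here ; (inj₂ p) → under p })
        (λ { (inj₁ tt) → refl ; (inj₂ p) → refl }) (λ { here → refl ; (under p) → refl })

Pos↔Fin-size : (t : Term n) → Pos t ↔ Fin (size t)
Pos↔Fin-size (var i)   =
  Pos↔⊤⊎NonRootPos (var i) ⟫ ⊎-cong (↔-sym 1↔⊤) (↔-sym 0↔⊥) ⟫ ↔-sym +↔⊎
Pos↔Fin-size (app t u) =
  Pos↔⊤⊎NonRootPos (app t u) ⟫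
  ⊎-cong (↔-sym 1↔⊤) (⊎-cong (Pos↔Fin-size t) (Pos↔Fin-size u) ⟫ ↔-sym +↔⊎) ⟫ ↔-sym +↔⊎
Pos↔Fin-size (lam t)   =
  Pos↔⊤⊎NonRootPos (lam t) ⟫ ⊎-cong (↔-sym 1↔⊤) (Pos↔Fin-size t) ⟫ ↔-sym +↔⊎

Σ-⊤ : {A : Set} → Σ A (λ _ → ⊤) ↔ A
Σ-⊤ = mk↔ₛ′ proj₁ (_, tt) (λ _ → refl) (λ _ → refl)

-- Fin n × BTerm n is the pointed class B• (a term of size n has n subterm occurrences).
pointed-BTerm↔ : (Fin n × BTerm n) ↔ (BTerm n ⊎ NonRootPointed n)
pointed-BTerm↔ {n} = ×-comm _ _ ⟫ congˡ (λ {V} → position↔ V) ⟫ Σ-distribˡ-⊎ ⟫ ⊎-cong Σ-⊤ ↔-refl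
  where
  position↔ : (V : BTerm n) → Fin n ↔ (⊤ ⊎ NonRootPos (proj₁ V))
  position↔ (t , refl , _) = ↔-sym (Pos↔Fin-size t) ⟫ Pos↔⊤⊎NonRootPos t

Splitting-≡ : {s s′ : Splitting m} → proj₁ s ≡ proj₁ s′ → proj₁ (proj₂ s) ≡ proj₁ (proj₂ s′) →
              s ≡ s′
Splitting-≡ {s = a , c , e} {.a , .c , e′} refl refl = cong (λ e → a , c , e) (≡-irrelevant e e′)

Fin↔Splitting : Fin (suc m) ↔ Splitting m
Fin↔Splitting {m} = mk↔ₛ′ to from to∘from (λ i → fromℕ<-toℕ i _)
  where
  to : Fin (suc m) → Splitting m
  to i = toℕ i , m ∸ toℕ i , m+[n∸m]≡n (toℕ≤pred[n] i)
  bound : (s : Splitting m) → proj₁ s ℕ.< suc m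
  bound (a , c , e) = s≤s (subst (a ℕ.≤_) e (m≤m+n a c))
  from : Splitting m → Fin (suc m)
  from s = fromℕ< (bound s)
  to∘from : ∀ s → to (from s) ≡ s
  to∘from s@(a , c , e) = Splitting-≡ (toℕ-fromℕ< (bound s)) (begin
    m ∸ toℕ (fromℕ< (bound s)) ≡⟨ cong (m ∸_) (toℕ-fromℕ< (bound s)) ⟩
    m ∸ a                      ≡⟨ cong (_∸ a) e ⟨
    a + c ∸ a                  ≡⟨ m+n∸m≡n a c ⟩
    c                          ∎)
    where open ≡-Reasoning

Convolution-cong : {A A′ C C′ : ℕ → Set} → (∀ a → A a ↔ A′ a) → (∀ c → C c ↔ C′ c) →
                   Convolution A C m ↔ Convolution A′ C′ m
Convolution-cong A↔ C↔ = congˡ (×-cong (A↔ _) (C↔ _))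

Convolution-⊎ : {A C D : ℕ → Set} →
                Convolution A (λ c → C c ⊎ D c) m ↔ (Convolution A C m ⊎ Convolution A D m)
Convolution-⊎ = congˡ ×-distribˡ-⊎ ⟫ Σ-distribˡ-⊎

Fin-sum-applyUpTo : ∀ k (s h : ℕ → ℕ) →
                    Fin (sum (map h (applyUpTo s k))) ↔ (Σ[ i ∈ Fin k ] Fin (h (s (toℕ i))))
Fin-sum-applyUpTo zero    s h = mk↔ₛ′ (λ ()) (λ { (() , _) }) (λ { (() , _) }) (λ ())
Fin-sum-applyUpTo (suc k) s h =
  +↔⊎ ⟫ ⊎-cong ↔-refl (Fin-sum-applyUpTo k (s ∘ suc) h) ⟫ Σ-Fin-suc
  where
  Σ-Fin-suc : {P : Fin (suc k) → Set} → (P zero ⊎ Σ[ i ∈ Fin k ] P (suc i)) ↔ Σ (Fin (suc k)) P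
  Σ-Fin-suc = mk↔ₛ′ (λ { (inj₁ x) → zero , x ; (inj₂ (i , x)) → suc i , x })
                    (λ { (zero , x) → inj₁ x ; (suc i , x) → inj₂ (i , x) })
                    (λ { (zero , _) → refl ; (suc _ , _) → refl })
                    (λ { (inj₁ _) → refl ; (inj₂ _) → refl })

Fin-⊗ : (f g : Series) (m : ℕ) → Fin ((f ⊗ g) m) ↔ Convolution (Fin ∘ f) (Fin ∘ g) m
Fin-⊗ f g m =
  Fin-sum-applyUpTo (suc m) id (λ i → f i * g (m ∸ i)) ⟫ congˡ *↔× ⟫ Σ-↔ Fin↔Splitting ↔-refl

Fin-2· : (f : Series) (n : ℕ) → Fin ((2 · f) n) ↔ (Bool × Fin (f n))
Fin-2· f n = *↔× ⟫ ×-cong 2↔Bool ↔-refl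

Z⊗-suc : (f : Series) (n : ℕ) → (Z ⊗ f) (suc n) ≡ f n
Z⊗-suc f n = trans (cong₂ _+_ (*-identityˡ (f n)) (tail≡0 n id)) (+-identityʳ (f n))
  where
  tail≡0 : ∀ k (s : ℕ → ℕ) →
           sum (map (λ i → Z i * f (suc n ∸ i)) (applyUpTo (λ i → suc (suc (s i))) k)) ≡ 0
  tail≡0 zero    s = refl
  tail≡0 (suc k) s = tail≡0 k (s ∘ suc)

Z⊗D : (f : Series) (n : ℕ) → (Z ⊗ D f) n ≡ n * f n
Z⊗D f zero    = refl
Z⊗D f (suc n) = Z⊗-suc (D f) n

Fin-Z⊗-suc : (f : Series) (n : ℕ) → Fin ((Z ⊗ f) (suc n)) ↔ Fin (f n)
Fin-Z⊗-suc f n = ≡⇒ (cong Fin (Z⊗-suc f n))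

Fin-Z : (n : ℕ) → Fin (Z n) ↔ (n ≡ 1)
Fin-Z 0 = mk↔ₛ′ (λ ()) (λ ()) (λ ()) (λ ())
Fin-Z 1 = mk↔ₛ′ (λ _ → refl) (λ _ → zero) (λ { refl → refl }) (λ { zero → refl })
Fin-Z (suc (suc n)) = mk↔ₛ′ (λ ()) (λ ()) (λ ()) (λ ())

¬BTerm0 : ¬ BTerm 0
¬BTerm0 (var _   , () , _)
¬BTerm0 (app _ _ , () , _)
¬BTerm0 (lam _   , () , _)

module _ (B : Series) (B↔ : ∀ n → Fin (B n) ↔ BTerm n) where

  B-zero : B 0 ≡ 0
  B-zero = ↔⇒≡ (B↔ 0 ⟫ mk↔ₛ′ (⊥-elim ∘ ¬BTerm0) (λ ()) (λ ()) (⊥-elim ∘ ¬BTerm0))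

  lhs↔ : ∀ m → Fin ((B ⊕ 2 · (Z ⊗ (B ⊗ B))) (suc m)) ↔
               (BTerm (suc m) ⊎ Bool × Convolution BTerm BTerm m)
  lhs↔ m = +↔⊎ ⟫ ⊎-cong (B↔ (suc m))
    (Fin-2· (Z ⊗ (B ⊗ B)) (suc m) ⟫
     ×-cong ↔-refl (Fin-Z⊗-suc (B ⊗ B) m ⟫ Fin-⊗ B B m ⟫ Convolution-cong B↔ B↔))

  rhs↔ : ∀ m → Fin (((Z ⊗ Z) ⊕ 2 · (Z ⊗ (B ⊗ (Z ⊗ D B)))) (suc m)) ↔
               ((m ≡ 1) ⊎ Bool × (Convolution BTerm BTerm m ⊎ Convolution BTerm NonRootPointed m))
  rhs↔ m = +↔⊎ ⟫ ⊎-cong (Fin-Z⊗-suc Z m ⟫ Fin-Z m)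
    (Fin-2· (Z ⊗ (B ⊗ (Z ⊗ D B))) (suc m) ⟫ ×-cong ↔-refl
      (Fin-Z⊗-suc (B ⊗ (Z ⊗ D B)) m ⟫ Fin-⊗ B (Z ⊗ D B) m ⟫
       Convolution-cong B↔ pointed↔ ⟫ Convolution-⊎))
    where
    pointed↔ : ∀ j → Fin ((Z ⊗ D B) j) ↔ (BTerm j ⊎ NonRootPointed j)
    pointed↔ j = ≡⇒ (cong Fin (Z⊗D B j)) ⟫ *↔× ⟫ ×-cong ↔-refl (B↔ j) ⟫ pointed-BTerm↔

mainTheorem13 : (B : Series) → (∀ n → Fin (B n) ↔ BTerm n) →
                ∀ n → (B ⊕ 2 · (Z ⊗ (B ⊗ B))) n ≡ ((Z ⊗ Z) ⊕ 2 · (Z ⊗ (B ⊗ (Z ⊗ D B)))) n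
mainTheorem13 B B↔ zero rewrite B-zero B B↔ = refl
mainTheorem13 B B↔ (suc m) = ↔⇒≡ (lhs↔ B B↔ m ⟫ regroup ⟫ ↔-sym (rhs↔ B B↔ m))
  where
  regroup : (BTerm (suc m) ⊎ Bool × Convolution BTerm BTerm m) ↔
            ((m ≡ 1) ⊎ Bool × (Convolution BTerm BTerm m ⊎ Convolution BTerm NonRootPointed m))
  regroup = ⊎-cong BTerm-suc↔ ↔-refl ⟫ ⊎-assoc _ _ _ _ ⟫
            ⊎-cong ↔-refl (⊎-comm _ _ ⟫ ↔-sym ×-distribˡ-⊎)
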